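{- Let $M$, $N$ be terms of $\lambda{*}U$ in the image of the reflection map with $M = N$ (convertible). Then $M^* = N^*$ (convertible in $\lambda{*}U{\approx}$).
   Context: $\lambda{*}U$ is the type-in-type pure type system $\lambda{*}$ (terms $* \mid x \mid \Pi x{:}A.B \mid \Sigma x{:}A.B \mid \lambda x{:}A.t \mid s\,t \mid (s,t) \mid \pi_1 t\mid\pi_2 t$, axiom $*:*$) extended with an inductive–recursive universe: $U:*$ with constructors $\hat\Pi,\hat\Sigma : \Pi A{:}U.(TA\to U)\to U$, $\hat * : U$, and $T:U\to *$ with $T(\hat\Pi A B)=\Pi a{:}TA.T(Ba)$, $T(\hat\Sigma AB)=\Sigma a{:}TA.T(Ba)$, $T(\hat *)=U$. Conversion ($=$) is the untyped congruence generated by $(\lambda x{:}A.s)\,t = s[t/x]$ and $\pi_i(t_1,t_2)=t_i$ (together with the defining equations of recursive functions). The reflection map sends $\lambda{*}$-terms to $\lambda{*}U$-terms by $\overline{*}=\hat *$, $\overline{x}=x$, $\overline{\Pi x{:}A.B}=\hat\Pi\,\overline{A}\,(\lambda x{:}T\overline{A}.\overline{B})$, similarly for $\Sigma$, and commuting with $\lambda$, application, pairing, projections. $\lambda{*}U{\approx}$ extends $\lambda{*}U$ by an indexed inductive–recursive definition of $\mathrm{Eq} : U\to U\to *$ together with $\mathrm{Rel} : \Pi\{A\,B : U\}.\ \mathrm{Eq}\,A\,B \to TA\to TB\to *$. Constructors: $\mathrm{refl}_{\hat *} : \mathrm{Eq}\,\hat *\,\hat *$; $\hat\Pi^* \{A\,A'{:}U\}\{B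 : TA\to U\}\{B':TA'\to U\}\,(A^* : \mathrm{Eq}\,A\,A')\,(B^* : \Pi a{:}TA\,\Pi a'{:}TA'\,\Pi a^*{:}\mathrm{Rel}\,A^*\,a\,a'.\ \mathrm{Eq}\,(Ba)\,(B'a')) : \mathrm{Eq}\,(\hat\Pi A B)\,(\hat\Pi A' B')$; and $\hat\Sigma^*$ analogously into $\mathrm{Eq}\,(\hat\Sigma AB)\,(\hat\Sigma A'B')$. Equations: $\mathrm{Rel}\,\mathrm{refl}_{\hat *}\,A\,B = \mathrm{Eq}\,A\,B$; $\mathrm{Rel}\,(\hat\Pi^* A^* B^*)\,f\,f' = \Pi x{:}TA\,\Pi x'{:}TA'\,\Pi x^*{:}\mathrm{Rel}\,A^*\,x\,x'.\ \mathrm{Rel}\,(B^*\,x\,x'\,x^*)\,(f x)\,(f' x')$; $\mathrm{Rel}\,(\hat\Sigma^* A^* B^*)\,p\,p' = \Sigma x^*{:}\mathrm{Rel}\,A^*(\pi_1 p)(\pi_1 p').\ \mathrm{Rel}\,(B^*(\pi_1p)(\pi_1p')x^*)\,(\pi_2p)\,(\pi_2p')$. Priming $(\cdot)'$ replaces every variable $x$ (free or bound) by a fresh variable $x'$; there are also fresh variables $x^*$, with unprimed, primed and starred variables pairwise disjoint. The operation $(\cdot)^*$ on terms in the image of reflection: $(x)^* = x^*$; $\hat *^* = \mathrm{refl}_{\hat *}$; $(\hat\Pi A(\lambda x{:}TA.B))^* = \hat\Pi^* A^*\,(\lambda x{:}TA\,\lambda x'{:}TA'\,\lambda x^*{:}\mathrm{Rel}\,A^*\,x\,x'.\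 B^*)$; analogously for $\hat\Sigma$ with $\hat\Sigma^*$; $(\lambda x{:}TA.b)^* = \lambda x{:}TA\,\lambda x'{:}TA'\,\lambda x^*{:}\mathrm{Rel}\,A^*\,x\,x'.\ b^*$; $(f\,a)^* = f^*\,a\,a'\,a^*$; $(a,b)^* = (a^*,b^*)$; $(\pi_i p)^* = \pi_i p^*$. -}

module Defs where

open import Data.Nat using (ℕ; zero; suc)
open import Data.Fin using (Fin; zero; suc)
open import Data.Bool using (Bool; true; false)

-- Raw terms of λ* (well-scoped de Bruijn syntax, n free variables)

data Pre (n : ℕ) : Set where
  var  : Fin n → Pre n
  ⋆    : Pre n
  Π    : Pre n → Pre (suc n) → Pre n
  Σ    : Pre n → Pre (suc n) → Pre n
  lam  : Pre n → Pre (suc n) → Pre n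
  app  : Pre n → Pre n → Pre n
  pair : Pre n → Pre n → Pre n
  fst  : Pre n → Pre n
  snd  : Pre n → Pre n

-- Raw terms of λ*U (index false) and λ*U≈ (index true).
-- Implicit arguments of constants are explicit in the untyped syntax:
--   Rel {A} {B} e x y,   Π̂* {A} {A'} {B} {B'} A* B*   (same for Σ̂*).

data Tm : Bool → ℕ → Set where
  var   : ∀ {e n} → Fin n → Tm e n
  ⋆     : ∀ {e n} → Tm e n
  Π     : ∀ {e n} → Tm e n → Tm e (suc n) → Tm e n
  Σ     : ∀ {e n} → Tm e n → Tm e (suc n) → Tm e n
  lam   : ∀ {e n} → Tm e n → Tm e (suc n) → Tm e n
  app   : ∀ {e n} → Tm e n → Tm e n → Tm e n
  pair  : ∀ {e n} → Tm e n → Tm e n → Tm e n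
  fst   : ∀ {e n} → Tm e n → Tm e n
  snd   : ∀ {e n} → Tm e n → Tm e n
  U     : ∀ {e n} → Tm e n
  T     : ∀ {e n} → Tm e n
  Π̂     : ∀ {e n} → Tm e n
  Σ̂     : ∀ {e n} → Tm e n
  ⋆̂     : ∀ {e n} → Tm e n
  Eq    : ∀ {n} → Tm true n
  Rel   : ∀ {n} → Tm true n
  refl⋆ : ∀ {n} → Tm true n
  Π̂*    : ∀ {n} → Tm true n
  Σ̂*    : ∀ {n} → Tm true n

infixl 9 _·_
_·_ : ∀ {e n} → Tm e n → Tm e n → Tm e n
_·_ = app

liftR : ∀ {n m} → (Fin n → Fin m) → Fin (suc n) → Fin (suc m)
liftR ρ zero    = zero
liftR ρ (suc i) = suc (ρ i)

ren : ∀ {e n m} → (Fin n → Fin m) → Tm e n → Tm e m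
ren ρ (var i)    = var (ρ i)
ren ρ ⋆          = ⋆
ren ρ (Π A B)    = Π (ren ρ A) (ren (liftR ρ) B)
ren ρ (Σ A B)    = Σ (ren ρ A) (ren (liftR ρ) B)
ren ρ (lam A t)  = lam (ren ρ A) (ren (liftR ρ) t)
ren ρ (app s t)  = app (ren ρ s) (ren ρ t)
ren ρ (pair s t) = pair (ren ρ s) (ren ρ t)
ren ρ (fst t)    = fst (ren ρ t)
ren ρ (snd t)    = snd (ren ρ t)
ren ρ U          = U
ren ρ T          = T
ren ρ Π̂          = Π̂
ren ρ Σ̂          = Σ̂
ren ρ ⋆̂          = ⋆̂
ren ρ Eq         = Eq
ren ρ Rel        = Rel
ren ρ refl⋆      = refl⋆
ren ρ Π̂*         = Π̂*
ren ρ Σ̂*         = Σ̂*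

wk : ∀ {e n} → Tm e n → Tm e (suc n)
wk = ren suc

liftS : ∀ {e n m} → (Fin n → Tm e m) → Fin (suc n) → Tm e (suc m)
liftS σ zero    = var zero
liftS σ (suc i) = wk (σ i)

sub : ∀ {e n m} → (Fin n → Tm e m) → Tm e n → Tm e m
sub σ (var i)    = σ i
sub σ ⋆          = ⋆
sub σ (Π A B)    = Π (sub σ A) (sub (liftS σ) B)
sub σ (Σ A B)    = Σ (sub σ A) (sub (liftS σ) B)
sub σ (lam A t)  = lam (sub σ A) (sub (liftS σ) t)
sub σ (app s t)  = app (sub σ s) (sub σ t)
sub σ (pair s t) = pair (sub σ s) (sub σ t)
sub σ (fst t)    = fst (sub σ t)
sub σ (snd t)    = snd (sub σ t)
sub σ U          = U
sub σ T          = T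
sub σ Π̂          = Π̂
sub σ Σ̂          = Σ̂
sub σ ⋆̂          = ⋆̂
sub σ Eq         = Eq
sub σ Rel        = Rel
sub σ refl⋆      = refl⋆
sub σ Π̂*         = Π̂*
sub σ Σ̂*         = Σ̂*

sub0 : ∀ {e n} → Tm e (suc n) → Tm e n → Tm e n
sub0 {e} {n} s t = sub σ s
  where
  σ : Fin (suc n) → Tm e n
  σ zero    = t
  σ (suc i) = var i

-- Conversion: the untyped congruence generated by β, the projection
-- rules and the defining equations of the recursive functions
-- (T in both systems; additionally Rel in λ*U≈, which only applies
-- to terms of index true since Rel only exists there).

infix 4 _≃_
data _≃_ : ∀ {e n} → Tm e n → Tm e n → Set where
  β       : ∀ {e n} (A : Tm e n) s t → app (lam A s) t ≃ sub0 s t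
  π₁β     : ∀ {e n} (s t : Tm e n) → fst (pair s t) ≃ s
  π₂β     : ∀ {e n} (s t : Tm e n) → snd (pair s t) ≃ t
  TΠ̂      : ∀ {e n} (A B : Tm e n) →
            T · (Π̂ · A · B) ≃ Π (T · A) (T · (wk B · var zero))
  TΣ̂      : ∀ {e n} (A B : Tm e n) →
            T · (Σ̂ · A · B) ≃ Σ (T · A) (T · (wk B · var zero))
  T⋆̂      : ∀ {e n} → T · ⋆̂ ≃ U {e} {n}
  Relrefl : ∀ {n} (X Y A B : Tm true n) →
            Rel · X · Y · refl⋆ · A · B ≃ Eq · A · B
  RelΠ̂*   : ∀ {n} (X Y A A' B B' A* B* f f' : Tm true n) →
            Rel · X · Y · (Π̂* · A · A' · B · B' · A* · B*) · f · f' ≃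
            Π (T · A) (Π (T · wk A')
              (Π (Rel · wk (wk A) · wk (wk A') · wk (wk A*) · var (suc zero) · var zero)
                 (Rel · (wk (wk (wk B)) · var (suc (suc zero)))
                      · (wk (wk (wk B')) · var (suc zero))
                      · (wk (wk (wk B*)) · var (suc (suc zero)) · var (suc zero) · var zero)
                      · (wk (wk (wk f)) · var (suc (suc zero)))
                      · (wk (wk (wk f')) · var (suc zero)))))
  RelΣ̂*   : ∀ {n} (X Y A A' B B' A* B* p p' : Tm true n) →
            Rel · X · Y · (Σ̂* · A · A' · B · B' · A* · B*) · p · p' ≃
            Σ (Rel · A · A' · A* · fst p · fst p')
              (Rel · (wk B · fst (wk p))
                   · (wk B' · fst (wk p'))
                   · (wk B* · fst (wk p) · fst (wk p') · var zero)
                   · snd (wk p)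
                   · snd (wk p'))
  ≃-refl  : ∀ {e n} {s : Tm e n} → s ≃ s
  ≃-sym   : ∀ {e n} {s t : Tm e n} → s ≃ t → t ≃ s
  ≃-trans : ∀ {e n} {s t u : Tm e n} → s ≃ t → t ≃ u → s ≃ u
  Π-cong    : ∀ {e n} {A A' : Tm e n} {B B'} → A ≃ A' → B ≃ B' → Π A B ≃ Π A' B'
  Σ-cong    : ∀ {e n} {A A' : Tm e n} {B B'} → A ≃ A' → B ≃ B' → Σ A B ≃ Σ A' B'
  lam-cong  : ∀ {e n} {A A' : Tm e n} {t t'} → A ≃ A' → t ≃ t' → lam A t ≃ lam A' t'
  app-cong  : ∀ {e n} {s s' t t' : Tm e n} → s ≃ s' → t ≃ t' → app s t ≃ app s' t'
  pair-cong : ∀ {e n} {s s' t t' : Tm e n} → s ≃ s' → t ≃ t' → pair s t ≃ pair s' t'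
  fst-cong  : ∀ {e n} {s s' : Tm e n} → s ≃ s' → fst s ≃ fst s'
  snd-cong  : ∀ {e n} {s s' : Tm e n} → s ≃ s' → snd s ≃ snd s'

emb : ∀ {n} → Tm false n → Tm true n
emb (var i)    = var i
emb ⋆          = ⋆
emb (Π A B)    = Π (emb A) (emb B)
emb (Σ A B)    = Σ (emb A) (emb B)
emb (lam A t)  = lam (emb A) (emb t)
emb (app s t)  = app (emb s) (emb t)
emb (pair s t) = pair (emb s) (emb t)
emb (fst t)    = fst (emb t)
emb (snd t)    = snd (emb t)
emb U          = U
emb T          = T
emb Π̂          = Π̂
emb Σ̂          = Σ̂
emb ⋆̂          = ⋆̂

reflect : ∀ {n} → Pre n → Tm false n
reflect (var i)    = var i
reflect ⋆          = ⋆̂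
reflect (Π A B)    = Π̂ · reflect A · lam (T · reflect A) (reflect B)
reflect (Σ A B)    = Σ̂ · reflect A · lam (T · reflect A) (reflect B)
reflect (lam A t)  = lam (T · reflect A) (reflect t)
reflect (app s t)  = app (reflect s) (reflect t)
reflect (pair s t) = pair (reflect s) (reflect t)
reflect (fst t)    = fst (reflect t)
reflect (snd t)    = snd (reflect t)

-- A source context of n variables x₁..xₙ becomes the target context
-- x₁, x₁', x₁*, …, xₙ, xₙ', xₙ* of 3n variables (binders introduced in
-- this order, so xᵢ* is innermost of each triple).

tri : ℕ → ℕ
tri zero    = zero
tri (suc n) = suc (suc (suc (tri n)))

unV prV stV : ∀ {n} → Fin n → Fin (tri n)
unV zero    = suc (suc zero)
unV (suc i) = suc (suc (suc (unV i)))
prV zero    = suc zero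
prV (suc i) = suc (suc (suc (prV i)))
stV zero    = zero
stV (suc i) = suc (suc (suc (stV i)))

unT prT : ∀ {n} → Tm false n → Tm true (tri n)
unT M = ren unV (emb M)
prT M = ren prV (emb M)

-- The operation (·)* on terms in the image of reflection.
-- For M = reflect m we write (reflect m)* as  star m : it is defined by
-- the clauses of the paper, read on the (unique) preimage m.

-- λ x:TA. λ x':TA'. λ x*:Rel A* x x'. b   (Rel's implicits are A, A')
lam³ : ∀ {n} → Pre n → Tm true (tri n) → Tm true (tri (suc n)) → Tm true (tri n)
lam³ A A* b =
  lam (T · unT (reflect A))
   (lam (T · wk (prT (reflect A)))
    (lam (Rel · wk (wk (unT (reflect A))) · wk (wk (prT (reflect A)))
              · wk (wk A*) · var (suc zero) · var zero)
     b))

star : ∀ {n} → Pre n → Tm true (tri n)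
star (var i)    = var (stV i)
star ⋆          = refl⋆
star (Π A B)    = Π̂* · unT (reflect A) · prT (reflect A)
                     · unT (lam (T · reflect A) (reflect B))
                     · prT (lam (T · reflect A) (reflect B))
                     · star A · lam³ A (star A) (star B)
star (Σ A B)    = Σ̂* · unT (reflect A) · prT (reflect A)
                     · unT (lam (T · reflect A) (reflect B))
                     · prT (lam (T · reflect A) (reflect B))
                     · star A · lam³ A (star A) (star B)
star (lam A t)  = lam³ A (star A) (star t)
star (app f a)  = star f · unT (reflect a) · prT (reflect a) · star a
star (pair a b) = pair (star a) (star b)
star (fst p)    = fst (star p)
star (snd p)    = snd (star p)

module Submission where

-- A conversion between reflected terms may pass through λ*U-terms that
-- are not reflections (e.g. unfolded instances of T), so (·)* is first
-- extended to a translation star⁺ of ALL raw λ*U-terms: the relational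
-- (parametricity) translation.  It sends a term over x₁ … xₙ to a term
-- over the tripled context x₁, x₁', x₁*, …, xₙ, xₙ', xₙ*, and sends the
-- constants U, T, Π̂, Σ̂, ⋆̂ to Eq, Rel, Π̂*, Σ̂*, refl⋆ (suitably
-- λ-abstracted).  Since conversion is untyped, binder annotations that
-- star⁺ introduces only need to be some term; we use ⋆.
-- The theorem follows:  star m ≃ star⁺ (reflect m) ≃ star⁺ (reflect k) ≃ star k.

open import Defs
open import Data.Nat using (ℕ; zero; suc)
open import Data.Fin using (Fin; zero; suc)
open import Data.Bool using (Bool; true; false)
open import Level using (0ℓ)
open import Relation.Binary.Bundles using (Setoid)
import Relation.Binary.Reasoning.Setoid as SetoidReasoning
open import Relation.Binary.PropositionalEquality
open import Function using (_∘_)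

cong₃ : ∀ {A B C D : Set} (f : A → B → C → D) {a a' b b' c c'} →
        a ≡ a' → b ≡ b' → c ≡ c' → f a b c ≡ f a' b' c'
cong₃ f refl refl refl = refl

cong₄ : ∀ {A B C D E : Set} (f : A → B → C → D → E) {a a' b b' c c' d d'} →
        a ≡ a' → b ≡ b' → c ≡ c' → d ≡ d' → f a b c d ≡ f a' b' c' d'
cong₄ f refl refl refl refl = refl

-- Fusion laws are stated with a
-- pointwise hypothesis on the composite (rather than a fixed composite),
-- which makes them reusable under binders without function extensionality.

liftR-ren-ren : ∀ {n m k} {ρ : Fin m → Fin k} {ρ' : Fin n → Fin m} {ρ'' : Fin n → Fin k} →
                (∀ i → ρ (ρ' i) ≡ ρ'' i) → ∀ i → liftR ρ (liftR ρ' i) ≡ liftR ρ'' i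
liftR-ren-ren h zero    = refl
liftR-ren-ren h (suc i) = cong suc (h i)

ren-ren : ∀ {e n m k} {ρ : Fin m → Fin k} {ρ' : Fin n → Fin m} {ρ'' : Fin n → Fin k} →
          (∀ i → ρ (ρ' i) ≡ ρ'' i) → (t : Tm e n) → ren ρ (ren ρ' t) ≡ ren ρ'' t
ren-ren h (var i)    = cong var (h i)
ren-ren h ⋆          = refl
ren-ren h U          = refl
ren-ren h T          = refl
ren-ren h Π̂          = refl
ren-ren h Σ̂          = refl
ren-ren h ⋆̂          = refl
ren-ren h Eq         = refl
ren-ren h Rel        = refl
ren-ren h refl⋆      = refl
ren-ren h Π̂*         = refl
ren-ren h Σ̂*         = refl
ren-ren h (Π A B)    = cong₂ Π (ren-ren h A) (ren-ren (liftR-ren-ren h) B)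
ren-ren h (Σ A B)    = cong₂ Σ (ren-ren h A) (ren-ren (liftR-ren-ren h) B)
ren-ren h (lam A B)  = cong₂ lam (ren-ren h A) (ren-ren (liftR-ren-ren h) B)
ren-ren h (app s t)  = cong₂ app (ren-ren h s) (ren-ren h t)
ren-ren h (pair s t) = cong₂ pair (ren-ren h s) (ren-ren h t)
ren-ren h (fst t)    = cong fst (ren-ren h t)
ren-ren h (snd t)    = cong snd (ren-ren h t)

liftS-sub-ren : ∀ {e n m k} {σ : Fin m → Tm e k} {ρ : Fin n → Fin m} {σ' : Fin n → Tm e k} →
                (∀ i → σ (ρ i) ≡ σ' i) → ∀ i → liftS σ (liftR ρ i) ≡ liftS σ' i
liftS-sub-ren h zero    = refl
liftS-sub-ren h (suc i) = cong wk (h i)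

sub-ren : ∀ {e n m k} {σ : Fin m → Tm e k} {ρ : Fin n → Fin m} {σ' : Fin n → Tm e k} →
          (∀ i → σ (ρ i) ≡ σ' i) → (t : Tm e n) → sub σ (ren ρ t) ≡ sub σ' t
sub-ren h (var i)    = h i
sub-ren h ⋆          = refl
sub-ren h U          = refl
sub-ren h T          = refl
sub-ren h Π̂          = refl
sub-ren h Σ̂          = refl
sub-ren h ⋆̂          = refl
sub-ren h Eq         = refl
sub-ren h Rel        = refl
sub-ren h refl⋆      = refl
sub-ren h Π̂*         = refl
sub-ren h Σ̂*         = refl
sub-ren h (Π A B)    = cong₂ Π (sub-ren h A) (sub-ren (liftS-sub-ren h) B)
sub-ren h (Σ A B)    = cong₂ Σ (sub-ren h A) (sub-ren (liftS-sub-ren h) B)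
sub-ren h (lam A B)  = cong₂ lam (sub-ren h A) (sub-ren (liftS-sub-ren h) B)
sub-ren h (app s t)  = cong₂ app (sub-ren h s) (sub-ren h t)
sub-ren h (pair s t) = cong₂ pair (sub-ren h s) (sub-ren h t)
sub-ren h (fst t)    = cong fst (sub-ren h t)
sub-ren h (snd t)    = cong snd (sub-ren h t)

ren-wk : ∀ {e n m} (ρ : Fin n → Fin m) (x : Tm e n) → ren (liftR ρ) (wk x) ≡ wk (ren ρ x)
ren-wk ρ x = trans (ren-ren (λ _ → refl) x) (sym (ren-ren (λ _ → refl) x))

liftS-ren-sub : ∀ {e n m k} {ρ : Fin m → Fin k} {σ : Fin n → Tm e m} {σ' : Fin n → Tm e k} →
                (∀ i → ren ρ (σ i) ≡ σ' i) → ∀ i → ren (liftR ρ) (liftS σ i) ≡ liftS σ' i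
liftS-ren-sub h zero                    = refl
liftS-ren-sub {ρ = ρ} {σ = σ} h (suc i) = trans (ren-wk ρ (σ i)) (cong wk (h i))

ren-sub : ∀ {e n m k} {ρ : Fin m → Fin k} {σ : Fin n → Tm e m} {σ' : Fin n → Tm e k} →
          (∀ i → ren ρ (σ i) ≡ σ' i) → (t : Tm e n) → ren ρ (sub σ t) ≡ sub σ' t
ren-sub h (var i)    = h i
ren-sub h ⋆          = refl
ren-sub h U          = refl
ren-sub h T          = refl
ren-sub h Π̂          = refl
ren-sub h Σ̂          = refl
ren-sub h ⋆̂          = refl
ren-sub h Eq         = refl
ren-sub h Rel        = refl
ren-sub h refl⋆      = refl
ren-sub h Π̂*         = refl
ren-sub h Σ̂*         = refl
ren-sub h (Π A B)    = cong₂ Π (ren-sub h A) (ren-sub (liftS-ren-sub h) B)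
ren-sub h (Σ A B)    = cong₂ Σ (ren-sub h A) (ren-sub (liftS-ren-sub h) B)
ren-sub h (lam A B)  = cong₂ lam (ren-sub h A) (ren-sub (liftS-ren-sub h) B)
ren-sub h (app s t)  = cong₂ app (ren-sub h s) (ren-sub h t)
ren-sub h (pair s t) = cong₂ pair (ren-sub h s) (ren-sub h t)
ren-sub h (fst t)    = cong fst (ren-sub h t)
ren-sub h (snd t)    = cong snd (ren-sub h t)

sub-wk : ∀ {e n m} (σ : Fin n → Tm e m) (x : Tm e n) → sub (liftS σ) (wk x) ≡ wk (sub σ x)
sub-wk σ x = trans (sub-ren (λ _ → refl) x) (sym (ren-sub (λ _ → refl) x))

liftS-sub-sub : ∀ {e n m k} {σ : Fin m → Tm e k} {τ : Fin n → Tm e m} {σ' : Fin n → Tm e k} →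
                (∀ i → sub σ (τ i) ≡ σ' i) → ∀ i → sub (liftS σ) (liftS τ i) ≡ liftS σ' i
liftS-sub-sub h zero                    = refl
liftS-sub-sub {σ = σ} {τ = τ} h (suc i) = trans (sub-wk σ (τ i)) (cong wk (h i))

sub-sub : ∀ {e n m k} {σ : Fin m → Tm e k} {τ : Fin n → Tm e m} {σ' : Fin n → Tm e k} →
          (∀ i → sub σ (τ i) ≡ σ' i) → (t : Tm e n) → sub σ (sub τ t) ≡ sub σ' t
sub-sub h (var i)    = h i
sub-sub h ⋆          = refl
sub-sub h U          = refl
sub-sub h T          = refl
sub-sub h Π̂          = refl
sub-sub h Σ̂          = refl
sub-sub h ⋆̂          = refl
sub-sub h Eq         = refl
sub-sub h Rel        = refl
sub-sub h refl⋆      = refl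
sub-sub h Π̂*         = refl
sub-sub h Σ̂*         = refl
sub-sub h (Π A B)    = cong₂ Π (sub-sub h A) (sub-sub (liftS-sub-sub h) B)
sub-sub h (Σ A B)    = cong₂ Σ (sub-sub h A) (sub-sub (liftS-sub-sub h) B)
sub-sub h (lam A B)  = cong₂ lam (sub-sub h A) (sub-sub (liftS-sub-sub h) B)
sub-sub h (app s t)  = cong₂ app (sub-sub h s) (sub-sub h t)
sub-sub h (pair s t) = cong₂ pair (sub-sub h s) (sub-sub h t)
sub-sub h (fst t)    = cong fst (sub-sub h t)
sub-sub h (snd t)    = cong snd (sub-sub h t)

liftS-id : ∀ {e n} {σ : Fin n → Tm e n} → (∀ i → σ i ≡ var i) → ∀ i → liftS σ i ≡ var i
liftS-id h zero    = refl
liftS-id h (suc i) = cong wk (h i)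

sub-id : ∀ {e n} {σ : Fin n → Tm e n} → (∀ i → σ i ≡ var i) → (t : Tm e n) → sub σ t ≡ t
sub-id h (var i)    = h i
sub-id h ⋆          = refl
sub-id h U          = refl
sub-id h T          = refl
sub-id h Π̂          = refl
sub-id h Σ̂          = refl
sub-id h ⋆̂          = refl
sub-id h Eq         = refl
sub-id h Rel        = refl
sub-id h refl⋆      = refl
sub-id h Π̂*         = refl
sub-id h Σ̂*         = refl
sub-id h (Π A B)    = cong₂ Π (sub-id h A) (sub-id (liftS-id h) B)
sub-id h (Σ A B)    = cong₂ Σ (sub-id h A) (sub-id (liftS-id h) B)
sub-id h (lam A B)  = cong₂ lam (sub-id h A) (sub-id (liftS-id h) B)
sub-id h (app s t)  = cong₂ app (sub-id h s) (sub-id h t)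
sub-id h (pair s t) = cong₂ pair (sub-id h s) (sub-id h t)
sub-id h (fst t)    = cong fst (sub-id h t)
sub-id h (snd t)    = cong snd (sub-id h t)

sub-ext : ∀ {e n m} {σ σ' : Fin n → Tm e m} → (∀ i → σ i ≡ σ' i) →
          (t : Tm e n) → sub σ t ≡ sub σ' t
sub-ext {σ = σ} h t = trans (cong (sub σ) (sym (sub-id (λ _ → refl) t))) (sub-sub h t)

ren-as-sub : ∀ {e n m} (ρ : Fin n → Fin m) (t : Tm e n) → ren ρ t ≡ sub (var ∘ ρ) t
ren-as-sub ρ t = trans (sym (sub-id (λ _ → refl) (ren ρ t))) (sub-ren (λ _ → refl) t)

ren-ext : ∀ {e n m} {ρ ρ' : Fin n → Fin m} → (∀ i → ρ i ≡ ρ' i) →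
          (t : Tm e n) → ren ρ t ≡ ren ρ' t
ren-ext {ρ = ρ} {ρ'} h t =
  trans (ren-as-sub ρ t) (trans (sub-ext (cong var ∘ h) t) (sym (ren-as-sub ρ' t)))

wk2 : ∀ {e n} → Tm e n → Tm e (suc (suc n))
wk2 x = wk (wk x)

wk3 : ∀ {e n} → Tm e n → Tm e (suc (suc (suc n)))
wk3 x = wk (wk2 x)

wk4 : ∀ {e n} → Tm e n → Tm e (suc (suc (suc (suc n))))
wk4 x = wk (wk3 x)

wk5 : ∀ {e n} → Tm e n → Tm e (suc (suc (suc (suc (suc n)))))
wk5 x = wk (wk4 x)

ren-wk2 : ∀ {e n m} (ρ : Fin n → Fin m) (x : Tm e n) →
          ren (liftR (liftR ρ)) (wk2 x) ≡ wk2 (ren ρ x)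
ren-wk2 ρ x = trans (ren-wk (liftR ρ) (wk x)) (cong wk (ren-wk ρ x))

ren-wk3 : ∀ {e n m} (ρ : Fin n → Fin m) (x : Tm e n) →
          ren (liftR (liftR (liftR ρ))) (wk3 x) ≡ wk3 (ren ρ x)
ren-wk3 ρ x = trans (ren-wk (liftR (liftR ρ)) (wk2 x)) (cong wk (ren-wk2 ρ x))

ren-wk4 : ∀ {e n m} (ρ : Fin n → Fin m) (x : Tm e n) →
          ren (liftR (liftR (liftR (liftR ρ)))) (wk4 x) ≡ wk4 (ren ρ x)
ren-wk4 ρ x = trans (ren-wk (liftR (liftR (liftR ρ))) (wk3 x)) (cong wk (ren-wk3 ρ x))

sub-wk2 : ∀ {e n m} (σ : Fin n → Tm e m) (x : Tm e n) →
          sub (liftS (liftS σ)) (wk2 x) ≡ wk2 (sub σ x)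
sub-wk2 σ x = trans (sub-wk (liftS σ) (wk x)) (cong wk (sub-wk σ x))

sub-wk3 : ∀ {e n m} (σ : Fin n → Tm e m) (x : Tm e n) →
          sub (liftS (liftS (liftS σ))) (wk3 x) ≡ wk3 (sub σ x)
sub-wk3 σ x = trans (sub-wk (liftS (liftS σ)) (wk2 x)) (cong wk (sub-wk2 σ x))

sub-wk4 : ∀ {e n m} (σ : Fin n → Tm e m) (x : Tm e n) →
          sub (liftS (liftS (liftS (liftS σ)))) (wk4 x) ≡ wk4 (sub σ x)
sub-wk4 σ x = trans (sub-wk (liftS (liftS (liftS σ))) (wk3 x)) (cong wk (sub-wk3 σ x))

sub-wk2-cancel : ∀ {e n} {σ : Fin (suc (suc n)) → Tm e n} → (∀ i → σ (suc (suc i)) ≡ var i) →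
                 (a : Tm e n) → sub σ (wk2 a) ≡ a
sub-wk2-cancel h a = trans (sub-ren (λ _ → refl) (wk a)) (trans (sub-ren (λ _ → refl) a) (sub-id h a))

sub-wk3-cancel : ∀ {e n} {σ : Fin (suc (suc (suc n))) → Tm e n} →
                 (∀ i → σ (suc (suc (suc i))) ≡ var i) → (a : Tm e n) → sub σ (wk3 a) ≡ a
sub-wk3-cancel h a = trans (sub-ren (λ _ → refl) (wk2 a)) (sub-wk2-cancel h a)

-- Simultaneous substitution of one, two or three terms for the innermost
-- variables (the last argument goes to the innermost variable).
σ₁ : ∀ {e n} → Tm e n → Fin (suc n) → Tm e n
σ₁ t zero    = t
σ₁ t (suc i) = var i

σ₂ : ∀ {e n} → Tm e n → Tm e n → Fin (suc (suc n)) → Tm e n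
σ₂ x y zero          = y
σ₂ x y (suc zero)    = x
σ₂ x y (suc (suc j)) = var j

σ₃ : ∀ {e n} → Tm e n → Tm e n → Tm e n → Fin (suc (suc (suc n))) → Tm e n
σ₃ a b c zero                = c
σ₃ a b c (suc zero)          = b
σ₃ a b c (suc (suc zero))    = a
σ₃ a b c (suc (suc (suc j))) = var j

sub0-as-sub : ∀ {e n} (s : Tm e (suc n)) (t : Tm e n) → sub0 s t ≡ sub (σ₁ t) s
sub0-as-sub s t = sub-ext (λ { zero → refl ; (suc i) → refl }) s

sub-sub0 : ∀ {e n m} (σ : Fin n → Tm e m) (s : Tm e (suc n)) t →
           sub σ (sub0 s t) ≡ sub0 (sub (liftS σ) s) (sub σ t)
sub-sub0 σ s t = begin
    sub σ (sub0 s t)                     ≡⟨ cong (sub σ) (sub0-as-sub s t) ⟩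
    sub σ (sub (σ₁ t) s)                 ≡⟨ sub-sub (λ _ → refl) s ⟩
    sub (λ i → sub σ (σ₁ t i)) s         ≡⟨ sym (sub-sub σ₁-lift s) ⟩
    sub (σ₁ (sub σ t)) (sub (liftS σ) s) ≡⟨ sym (sub0-as-sub (sub (liftS σ) s) (sub σ t)) ⟩
    sub0 (sub (liftS σ) s) (sub σ t)     ∎
  where
  open ≡-Reasoning
  σ₁-lift : ∀ i → sub (σ₁ (sub σ t)) (liftS σ i) ≡ sub σ (σ₁ t i)
  σ₁-lift zero    = refl
  σ₁-lift (suc i) = trans (sub-ren (λ _ → refl) (σ i)) (sub-id (λ _ → refl) (σ i))

emb-ren : ∀ {n m} (ρ : Fin n → Fin m) (t : Tm false n) → emb (ren ρ t) ≡ ren ρ (emb t)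
emb-ren ρ (var i)    = refl
emb-ren ρ ⋆          = refl
emb-ren ρ U          = refl
emb-ren ρ T          = refl
emb-ren ρ Π̂          = refl
emb-ren ρ Σ̂          = refl
emb-ren ρ ⋆̂          = refl
emb-ren ρ (Π A B)    = cong₂ Π (emb-ren ρ A) (emb-ren (liftR ρ) B)
emb-ren ρ (Σ A B)    = cong₂ Σ (emb-ren ρ A) (emb-ren (liftR ρ) B)
emb-ren ρ (lam A B)  = cong₂ lam (emb-ren ρ A) (emb-ren (liftR ρ) B)
emb-ren ρ (app s t)  = cong₂ app (emb-ren ρ s) (emb-ren ρ t)
emb-ren ρ (pair s t) = cong₂ pair (emb-ren ρ s) (emb-ren ρ t)
emb-ren ρ (fst t)    = cong fst (emb-ren ρ t)
emb-ren ρ (snd t)    = cong snd (emb-ren ρ t)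

liftS-emb : ∀ {n m} {σ : Fin n → Tm false m} {σ' : Fin n → Tm true m} →
            (∀ i → emb (σ i) ≡ σ' i) → ∀ i → emb (liftS σ i) ≡ liftS σ' i
liftS-emb h zero              = refl
liftS-emb {σ = σ} h (suc i) = trans (emb-ren suc (σ i)) (cong wk (h i))

emb-sub : ∀ {n m} {σ : Fin n → Tm false m} {σ' : Fin n → Tm true m} →
          (∀ i → emb (σ i) ≡ σ' i) → (t : Tm false n) → emb (sub σ t) ≡ sub σ' (emb t)
emb-sub h (var i)    = h i
emb-sub h ⋆          = refl
emb-sub h U          = refl
emb-sub h T          = refl
emb-sub h Π̂          = refl
emb-sub h Σ̂          = refl
emb-sub h ⋆̂          = refl
emb-sub h (Π A B)    = cong₂ Π (emb-sub h A) (emb-sub (liftS-emb h) B)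
emb-sub h (Σ A B)    = cong₂ Σ (emb-sub h A) (emb-sub (liftS-emb h) B)
emb-sub h (lam A B)  = cong₂ lam (emb-sub h A) (emb-sub (liftS-emb h) B)
emb-sub h (app s t)  = cong₂ app (emb-sub h s) (emb-sub h t)
emb-sub h (pair s t) = cong₂ pair (emb-sub h s) (emb-sub h t)
emb-sub h (fst t)    = cong fst (emb-sub h t)
emb-sub h (snd t)    = cong snd (emb-sub h t)

emb-sub0 : ∀ {n} (s : Tm false (suc n)) t → emb (sub0 s t) ≡ sub0 (emb s) (emb t)
emb-sub0 s t = trans (cong emb (sub0-as-sub s t))
  (trans (emb-sub {σ' = σ₁ (emb t)} (λ { zero → refl ; (suc i) → refl }) s)
         (sym (sub0-as-sub (emb s) (emb t))))

≡→≃ : ∀ {e n} {s t : Tm e n} → s ≡ t → s ≃ t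
≡→≃ refl = ≃-refl

-- Each generating equation is stable under substitution, since
-- substitution commutes with single substitution and with weakening.
sub-≃ : ∀ {e n m} (σ : Fin n → Tm e m) {s t : Tm e n} → s ≃ t → sub σ s ≃ sub σ t
sub-≃ σ (β A s t) = subst (sub σ (app (lam A s) t) ≃_) (sym (sub-sub0 σ s t)) (β _ _ _)
sub-≃ σ (π₁β s t) = π₁β _ _
sub-≃ σ (π₂β s t) = π₂β _ _
sub-≃ σ (TΠ̂ A B) rewrite sub-wk σ B = TΠ̂ _ _
sub-≃ σ (TΣ̂ A B) rewrite sub-wk σ B = TΣ̂ _ _
sub-≃ σ T⋆̂ = T⋆̂
sub-≃ σ (Relrefl X Y A B) = Relrefl _ _ _ _
sub-≃ σ (RelΠ̂* X Y A A' B B' A* B* f f')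
  rewrite sub-wk σ A' | sub-wk2 σ A | sub-wk2 σ A' | sub-wk2 σ A*
        | sub-wk3 σ B | sub-wk3 σ B' | sub-wk3 σ B* | sub-wk3 σ f | sub-wk3 σ f'
  = RelΠ̂* _ _ _ _ _ _ _ _ _ _
sub-≃ σ (RelΣ̂* X Y A A' B B' A* B* p p')
  rewrite sub-wk σ B | sub-wk σ B' | sub-wk σ B* | sub-wk σ p | sub-wk σ p'
  = RelΣ̂* _ _ _ _ _ _ _ _ _ _
sub-≃ σ ≃-refl          = ≃-refl
sub-≃ σ (≃-sym p)       = ≃-sym (sub-≃ σ p)
sub-≃ σ (≃-trans p q)   = ≃-trans (sub-≃ σ p) (sub-≃ σ q)
sub-≃ σ (Π-cong p q)    = Π-cong (sub-≃ σ p) (sub-≃ (liftS σ) q)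
sub-≃ σ (Σ-cong p q)    = Σ-cong (sub-≃ σ p) (sub-≃ (liftS σ) q)
sub-≃ σ (lam-cong p q)  = lam-cong (sub-≃ σ p) (sub-≃ (liftS σ) q)
sub-≃ σ (app-cong p q)  = app-cong (sub-≃ σ p) (sub-≃ σ q)
sub-≃ σ (pair-cong p q) = pair-cong (sub-≃ σ p) (sub-≃ σ q)
sub-≃ σ (fst-cong p)    = fst-cong (sub-≃ σ p)
sub-≃ σ (snd-cong p)    = snd-cong (sub-≃ σ p)

ren-≃ : ∀ {e n m} (ρ : Fin n → Fin m) {s t : Tm e n} → s ≃ t → ren ρ s ≃ ren ρ t
ren-≃ ρ {s} {t} p = ≃-trans (≡→≃ (ren-as-sub ρ s))
                      (≃-trans (sub-≃ (var ∘ ρ) p) (≡→≃ (sym (ren-as-sub ρ t))))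

wk-≃ : ∀ {e n} {s t : Tm e n} → s ≃ t → wk s ≃ wk t
wk-≃ = ren-≃ suc

emb-≃ : ∀ {n} {s t : Tm false n} → s ≃ t → emb s ≃ emb t
emb-≃ (β A s t) = subst (emb (app (lam A s) t) ≃_) (sym (emb-sub0 s t)) (β _ _ _)
emb-≃ (π₁β s t) = π₁β _ _
emb-≃ (π₂β s t) = π₂β _ _
emb-≃ (TΠ̂ A B) rewrite emb-ren suc B = TΠ̂ _ _
emb-≃ (TΣ̂ A B) rewrite emb-ren suc B = TΣ̂ _ _
emb-≃ T⋆̂ = T⋆̂
emb-≃ ≃-refl          = ≃-refl
emb-≃ (≃-sym p)       = ≃-sym (emb-≃ p)
emb-≃ (≃-trans p q)   = ≃-trans (emb-≃ p) (emb-≃ q)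
emb-≃ (Π-cong p q)    = Π-cong (emb-≃ p) (emb-≃ q)
emb-≃ (Σ-cong p q)    = Σ-cong (emb-≃ p) (emb-≃ q)
emb-≃ (lam-cong p q)  = lam-cong (emb-≃ p) (emb-≃ q)
emb-≃ (app-cong p q)  = app-cong (emb-≃ p) (emb-≃ q)
emb-≃ (pair-cong p q) = pair-cong (emb-≃ p) (emb-≃ q)
emb-≃ (fst-cong p)    = fst-cong (emb-≃ p)
emb-≃ (snd-cong p)    = snd-cong (emb-≃ p)

unT-≃ : ∀ {n} {s t : Tm false n} → s ≃ t → unT s ≃ unT t
unT-≃ p = ren-≃ unV (emb-≃ p)

prT-≃ : ∀ {n} {s t : Tm false n} → s ≃ t → prT s ≃ prT t
prT-≃ p = ren-≃ prV (emb-≃ p)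

≃-setoid : Bool → ℕ → Setoid 0ℓ 0ℓ
≃-setoid e n = record
  { Carrier       = Tm e n
  ; _≈_           = _≃_
  ; isEquivalence = record { refl = ≃-refl ; sym = ≃-sym ; trans = ≃-trans }
  }

app2-cong : ∀ {e n} {s s' : Tm e n} (x y : Tm e n) → s ≃ s' → s · x · y ≃ s' · x · y
app2-cong x y p = app-cong (app-cong p ≃-refl) ≃-refl

β₁ : ∀ {e n} (X : Tm e n) (b : Tm e (suc n)) x → app (lam X b) x ≃ sub (σ₁ x) b
β₁ X b x = ≃-trans (β X b x) (≡→≃ (sub0-as-sub b x))

β₂ : ∀ {e n} (X : Tm e n) (Y : Tm e (suc n)) (b : Tm e (suc (suc n))) x y →
     lam X (lam Y b) · x · y ≃ sub (σ₂ x y) b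
β₂ X Y b x y = ≃-trans (app-cong (β₁ X (lam Y b) x) ≃-refl)
               (≃-trans (β₁ _ _ y) (≡→≃ (sub-sub σ₂-split b)))
  where
  σ₂-split : ∀ i → sub (σ₁ y) (liftS (σ₁ x) i) ≡ σ₂ x y i
  σ₂-split zero          = refl
  σ₂-split (suc zero)    = trans (sub-ren (λ _ → refl) x) (sub-id (λ _ → refl) x)
  σ₂-split (suc (suc j)) = refl

β₃ : ∀ {e n} (X : Tm e n) (Y : Tm e (suc n)) (Z : Tm e (suc (suc n)))
     (b : Tm e (suc (suc (suc n)))) x y z →
     lam X (lam Y (lam Z b)) · x · y · z ≃ sub (σ₃ x y z) b
β₃ X Y Z b x y z = ≃-trans (app2-cong y z (β₁ X (lam Y (lam Z b)) x))
                   (≃-trans (β₂ _ _ _ y z) (≡→≃ (sub-sub σ₃-split b)))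
  where
  σ₃-split : ∀ i → sub (σ₂ y z) (liftS (liftS (σ₁ x)) i) ≡ σ₃ x y z i
  σ₃-split zero                = refl
  σ₃-split (suc zero)          = refl
  σ₃-split (suc (suc zero))    = sub-wk2-cancel (λ _ → refl) x
  σ₃-split (suc (suc (suc j))) = refl

v0 : ∀ {e n} → Tm e (suc n)
v0 = var zero

v1 : ∀ {e n} → Tm e (suc (suc n))
v1 = var (suc zero)

v2 : ∀ {e n} → Tm e (suc (suc (suc n)))
v2 = var (suc (suc zero))

v3 : ∀ {e n} → Tm e (suc (suc (suc (suc n))))
v3 = var (suc (suc (suc zero)))

v4 : ∀ {e n} → Tm e (suc (suc (suc (suc (suc n)))))
v4 = var (suc (suc (suc (suc zero))))

v5 : ∀ {e n} → Tm e (suc (suc (suc (suc (suc (suc n))))))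
v5 = var (suc (suc (suc (suc (suc zero)))))

-- Translations of the constants.  A constant c of λ*U takes its arguments
-- as triples (a, a', a*); e.g. T⁺ A A' A* x x' = Rel A A' A* x x', and
-- Π̂⁺ reorders its six arguments into those of Π̂*.
U⁺ T⁺ Π̂⁺ Σ̂⁺ : ∀ {n} → Tm true n
U⁺  = lam ⋆ (lam ⋆ (Eq · v1 · v0))
T⁺  = lam ⋆ (lam ⋆ (lam ⋆ (lam ⋆ (lam ⋆ (Rel · v4 · v3 · v2 · v1 · v0)))))
Π̂⁺ = lam ⋆ (lam ⋆ (lam ⋆ (lam ⋆ (lam ⋆ (lam ⋆ (Π̂* · v5 · v4 · v2 · v1 · v3 · v0))))))
Σ̂⁺ = lam ⋆ (lam ⋆ (lam ⋆ (lam ⋆ (lam ⋆ (lam ⋆ (Σ̂* · v5 · v4 · v2 · v1 · v3 · v0))))))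

-- The relation of a Π-type: functions f, f' are related when they map
-- related x, x' (witness x*) to related results.  Context of the body:
-- f, f', x, x', x*.
relΠ : ∀ {n} → Tm true (suc (suc n)) → Tm true (suc (suc (suc n))) →
       Tm true (suc (suc (suc (suc n)))) → Tm true (suc (suc (suc (suc (suc n))))) → Tm true n
relΠ A A' A* B* = lam ⋆ (lam ⋆ (Π A (Π A' (Π (A* · v1 · v0) (B* · (v4 · v2) · (v3 · v1))))))

-- The relation of a Σ-type: componentwise.  Context of the second
-- component: p, p', x* (the witness relating the first components).
relΣ : ∀ {n} → Tm true (suc (suc n)) → Tm true (suc (suc (suc n))) → Tm true n
relΣ A* B* = lam ⋆ (lam ⋆ (Σ (A* · fst v1 · fst v0) (B* · snd v2 · snd v1)))

lamRel : ∀ {n} → Tm true n → Tm true (suc n) → Tm true (suc (suc n)) →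
         Tm true (suc (suc (suc n))) → Tm true n
lamRel A A' A* b = lam A (lam A' (lam (A* · v1 · v0) b))

-- Moves the triple x, x', x* of a Π-body past the two new variables f, f'.
skip₂ : ∀ {n} → Fin (suc (suc (suc n))) → Fin (suc (suc (suc (suc (suc n)))))
skip₂ = liftR (liftR (liftR (λ i → suc (suc i))))

-- Instantiates the triple x, x', x* of a Σ-body by fst p, fst p', x*.
projΣ : ∀ {n} → Fin (suc (suc (suc n))) → Tm true (suc (suc (suc n)))
projΣ zero                = v0
projΣ (suc zero)          = fst v1
projΣ (suc (suc zero))    = fst v2
projΣ (suc (suc (suc j))) = var (suc (suc (suc j)))

-- No conversion rule
-- inspects the sort ⋆, so its image is immaterial; we keep it as ⋆.
star⁺ : ∀ {n} → Tm false n → Tm true (tri n)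
star⁺ (var i)    = var (stV i)
star⁺ ⋆          = ⋆
star⁺ U          = U⁺
star⁺ T          = T⁺
star⁺ Π̂          = Π̂⁺
star⁺ Σ̂          = Σ̂⁺
star⁺ ⋆̂          = refl⋆
star⁺ (Π A B)    = relΠ (wk2 (unT A)) (wk3 (prT A)) (wk4 (star⁺ A)) (ren skip₂ (star⁺ B))
star⁺ (Σ A B)    = relΣ (wk2 (star⁺ A)) (sub projΣ (star⁺ B))
star⁺ (lam A t)  = lamRel (unT A) (wk (prT A)) (wk2 (star⁺ A)) (star⁺ t)
star⁺ (app s t)  = star⁺ s · unT t · prT t · star⁺ t
star⁺ (pair s t) = pair (star⁺ s) (star⁺ t)
star⁺ (fst t)    = fst (star⁺ t)
star⁺ (snd t)    = snd (star⁺ t)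

-- star⁺ commutes with renaming: a renaming ρ of the source context
-- induces the renaming ren³ ρ of the tripled context, acting on each
-- triple x, x', x* (s3 skips one triple).

s3 : ∀ {n} → Fin n → Fin (suc (suc (suc n)))
s3 i = suc (suc (suc i))

ren³ : ∀ {n m} → (Fin n → Fin m) → Fin (tri n) → Fin (tri m)
ren³ {suc n} ρ zero                = stV (ρ zero)
ren³ {suc n} ρ (suc zero)          = prV (ρ zero)
ren³ {suc n} ρ (suc (suc zero))    = unV (ρ zero)
ren³ {suc n} ρ (suc (suc (suc j))) = ren³ (ρ ∘ suc) j

ren³-stV : ∀ {n m} (ρ : Fin n → Fin m) i → ren³ ρ (stV i) ≡ stV (ρ i)
ren³-stV ρ zero    = refl
ren³-stV ρ (suc i) = ren³-stV (ρ ∘ suc) i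

ren³-prV : ∀ {n m} (ρ : Fin n → Fin m) i → ren³ ρ (prV i) ≡ prV (ρ i)
ren³-prV ρ zero    = refl
ren³-prV ρ (suc i) = ren³-prV (ρ ∘ suc) i

ren³-unV : ∀ {n m} (ρ : Fin n → Fin m) i → ren³ ρ (unV i) ≡ unV (ρ i)
ren³-unV ρ zero    = refl
ren³-unV ρ (suc i) = ren³-unV (ρ ∘ suc) i

ren³-suc : ∀ {n m} (ρ : Fin n → Fin m) j → ren³ (suc ∘ ρ) j ≡ s3 (ren³ ρ j)
ren³-suc {suc n} ρ zero                = refl
ren³-suc {suc n} ρ (suc zero)          = refl
ren³-suc {suc n} ρ (suc (suc zero))    = refl
ren³-suc {suc n} ρ (suc (suc (suc j))) = ren³-suc (ρ ∘ suc) j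

ren³-id : ∀ {n} (j : Fin (tri n)) → ren³ (λ i → i) j ≡ j
ren³-id {suc n} zero                = refl
ren³-id {suc n} (suc zero)          = refl
ren³-id {suc n} (suc (suc zero))    = refl
ren³-id {suc n} (suc (suc (suc j))) = trans (ren³-suc (λ i → i) j) (cong s3 (ren³-id j))

ren³-wk : ∀ {n} (j : Fin (tri n)) → ren³ suc j ≡ s3 j
ren³-wk j = trans (ren³-suc (λ i → i) j) (cong s3 (ren³-id j))

ren³-liftR : ∀ {n m} (ρ : Fin n → Fin m) j → ren³ (liftR ρ) j ≡ liftR (liftR (liftR (ren³ ρ))) j
ren³-liftR ρ zero                = refl
ren³-liftR ρ (suc zero)          = refl
ren³-liftR ρ (suc (suc zero))    = refl
ren³-liftR ρ (suc (suc (suc j))) = ren³-suc ρ j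

unT-ren : ∀ {n m} (ρ : Fin n → Fin m) t → unT (ren ρ t) ≡ ren (ren³ ρ) (unT t)
unT-ren ρ t = trans (cong (ren unV) (emb-ren ρ t))
  (trans (ren-ren (λ _ → refl) (emb t)) (sym (ren-ren (ren³-unV ρ) (emb t))))

prT-ren : ∀ {n m} (ρ : Fin n → Fin m) t → prT (ren ρ t) ≡ ren (ren³ ρ) (prT t)
prT-ren ρ t = trans (cong (ren prV) (emb-ren ρ t))
  (trans (ren-ren (λ _ → refl) (emb t)) (sym (ren-ren (ren³-prV ρ) (emb t))))

skip₂-ren³ : ∀ {n m} (ρ : Fin n → Fin m) j →
             liftR (liftR (liftR (liftR (liftR (ren³ ρ))))) (skip₂ j) ≡ skip₂ (ren³ (liftR ρ) j)
skip₂-ren³ ρ zero                = refl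
skip₂-ren³ ρ (suc zero)          = refl
skip₂-ren³ ρ (suc (suc zero))    = refl
skip₂-ren³ ρ (suc (suc (suc k))) = sym (cong skip₂ (ren³-suc ρ k))

projΣ-ren³ : ∀ {n m} (ρ : Fin n → Fin m) j →
             projΣ (ren³ (liftR ρ) j) ≡ ren (liftR (liftR (liftR (ren³ ρ)))) (projΣ j)
projΣ-ren³ ρ zero                = refl
projΣ-ren³ ρ (suc zero)          = refl
projΣ-ren³ ρ (suc (suc zero))    = refl
projΣ-ren³ ρ (suc (suc (suc k))) = cong projΣ (ren³-suc ρ k)

star⁺-ren : ∀ {n m} (ρ : Fin n → Fin m) (t : Tm false n) → star⁺ (ren ρ t) ≡ ren (ren³ ρ) (star⁺ t)
star⁺-ren ρ (var i) = cong var (sym (ren³-stV ρ i))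
star⁺-ren ρ ⋆       = refl
star⁺-ren ρ U       = refl
star⁺-ren ρ T       = refl
star⁺-ren ρ Π̂       = refl
star⁺-ren ρ Σ̂       = refl
star⁺-ren ρ ⋆̂       = refl
star⁺-ren ρ (Π A B) = cong₄ relΠ
  (trans (cong wk2 (unT-ren ρ A)) (sym (ren-wk2 (ren³ ρ) (unT A))))
  (trans (cong wk3 (prT-ren ρ A)) (sym (ren-wk3 (ren³ ρ) (prT A))))
  (trans (cong wk4 (star⁺-ren ρ A)) (sym (ren-wk4 (ren³ ρ) (star⁺ A))))
  (trans (cong (ren skip₂) (star⁺-ren (liftR ρ) B))
    (trans (ren-ren (λ _ → refl) (star⁺ B)) (sym (ren-ren (skip₂-ren³ ρ) (star⁺ B)))))
star⁺-ren ρ (Σ A B) = cong₂ relΣ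
  (trans (cong wk2 (star⁺-ren ρ A)) (sym (ren-wk2 (ren³ ρ) (star⁺ A))))
  (trans (cong (sub projΣ) (star⁺-ren (liftR ρ) B))
    (trans (sub-ren (λ _ → refl) (star⁺ B))
      (trans (sub-ext (projΣ-ren³ ρ) (star⁺ B)) (sym (ren-sub (λ _ → refl) (star⁺ B))))))
star⁺-ren ρ (lam A t) = cong₄ lamRel (unT-ren ρ A)
  (trans (cong wk (prT-ren ρ A)) (sym (ren-wk (ren³ ρ) (prT A))))
  (trans (cong wk2 (star⁺-ren ρ A)) (sym (ren-wk2 (ren³ ρ) (star⁺ A))))
  (trans (star⁺-ren (liftR ρ) t) (ren-ext (ren³-liftR ρ) (star⁺ t)))
star⁺-ren ρ (app s t)  = cong₄ (λ a b c d → a · b · c · d)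
  (star⁺-ren ρ s) (unT-ren ρ t) (prT-ren ρ t) (star⁺-ren ρ t)
star⁺-ren ρ (pair s t) = cong₂ pair (star⁺-ren ρ s) (star⁺-ren ρ t)
star⁺-ren ρ (fst t)    = cong fst (star⁺-ren ρ t)
star⁺-ren ρ (snd t)    = cong snd (star⁺-ren ρ t)

wk3-as-ren : ∀ {e n} (x : Tm e n) → wk3 x ≡ ren s3 x
wk3-as-ren x = trans (cong wk (ren-ren (λ _ → refl) x)) (ren-ren (λ _ → refl) x)

ren³-suc-wk3 : ∀ {e n} (x : Tm e (tri n)) → ren (ren³ suc) x ≡ wk3 x
ren³-suc-wk3 x = trans (ren-ext ren³-wk x) (sym (wk3-as-ren x))

star⁺-wk : ∀ {n} (t : Tm false n) → star⁺ (wk t) ≡ wk3 (star⁺ t)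
star⁺-wk t = trans (star⁺-ren suc t) (ren³-suc-wk3 (star⁺ t))

unT-wk : ∀ {n} (t : Tm false n) → unT (wk t) ≡ wk3 (unT t)
unT-wk t = trans (unT-ren suc t) (ren³-suc-wk3 (unT t))

prT-wk : ∀ {n} (t : Tm false n) → prT (wk t) ≡ wk3 (prT t)
prT-wk t = trans (prT-ren suc t) (ren³-suc-wk3 (prT t))

-- skip₂ and projΣ only move the innermost triple, so they fix
-- triply weakened terms (up to the two extra weakenings of skip₂).
skip₂-wk3 : ∀ {e n} (x : Tm e n) → ren skip₂ (wk3 x) ≡ wk5 x
skip₂-wk3 x = trans (cong (ren skip₂) (wk3-as-ren x)) (trans (ren-ren (λ _ → refl) x)
  (sym (trans (cong wk2 (wk3-as-ren x)) (trans (cong wk (ren-ren (λ _ → refl) x))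
                                               (ren-ren (λ _ → refl) x)))))

projΣ-wk3 : ∀ {n} (x : Tm true n) → sub projΣ (wk3 x) ≡ wk3 x
projΣ-wk3 x = trans (cong (sub projΣ) (wk3-as-ren x)) (trans (sub-ren (λ _ → refl) x)
  (trans (sym (ren-as-sub s3 x)) (sym (wk3-as-ren x))))

-- star⁺ commutes with substitution: a substitution σ of λ*U-terms
-- induces the tripled substitution sub³ σ sending x, x', x* to
-- unT (σ x), prT (σ x), star⁺ (σ x).

sub³ : ∀ {n m} → (Fin n → Tm false m) → Fin (tri n) → Tm true (tri m)
sub³ {suc n} σ zero                = star⁺ (σ zero)
sub³ {suc n} σ (suc zero)          = prT (σ zero)
sub³ {suc n} σ (suc (suc zero))    = unT (σ zero)
sub³ {suc n} σ (suc (suc (suc j))) = sub³ (σ ∘ suc) j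

sub³-stV : ∀ {n m} (σ : Fin n → Tm false m) i → sub³ σ (stV i) ≡ star⁺ (σ i)
sub³-stV σ zero    = refl
sub³-stV σ (suc i) = sub³-stV (σ ∘ suc) i

sub³-prV : ∀ {n m} (σ : Fin n → Tm false m) i → sub³ σ (prV i) ≡ prT (σ i)
sub³-prV σ zero    = refl
sub³-prV σ (suc i) = sub³-prV (σ ∘ suc) i

sub³-unV : ∀ {n m} (σ : Fin n → Tm false m) i → sub³ σ (unV i) ≡ unT (σ i)
sub³-unV σ zero    = refl
sub³-unV σ (suc i) = sub³-unV (σ ∘ suc) i

sub³-wk : ∀ {n m} (σ : Fin n → Tm false m) j → sub³ (wk ∘ σ) j ≡ wk3 (sub³ σ j)
sub³-wk {suc n} σ zero                = star⁺-wk (σ zero)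
sub³-wk {suc n} σ (suc zero)          = prT-wk (σ zero)
sub³-wk {suc n} σ (suc (suc zero))    = unT-wk (σ zero)
sub³-wk {suc n} σ (suc (suc (suc j))) = sub³-wk (σ ∘ suc) j

sub³-liftS : ∀ {n m} (σ : Fin n → Tm false m) j →
             sub³ (liftS σ) j ≡ liftS (liftS (liftS (sub³ σ))) j
sub³-liftS σ zero                = refl
sub³-liftS σ (suc zero)          = refl
sub³-liftS σ (suc (suc zero))    = refl
sub³-liftS σ (suc (suc (suc j))) = sub³-wk σ j

sub³-var : ∀ {n m} (ρ : Fin n → Fin m) j → sub³ (var ∘ ρ) j ≡ var (ren³ ρ j)
sub³-var {suc n} ρ zero                = refl
sub³-var {suc n} ρ (suc zero)          = refl
sub³-var {suc n} ρ (suc (suc zero))    = refl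
sub³-var {suc n} ρ (suc (suc (suc j))) = sub³-var (ρ ∘ suc) j

unT-sub : ∀ {n m} (σ : Fin n → Tm false m) t → unT (sub σ t) ≡ sub (sub³ σ) (unT t)
unT-sub σ t = trans (cong (ren unV) (emb-sub (λ _ → refl) t))
  (trans (ren-sub (λ _ → refl) (emb t)) (sym (sub-ren (sub³-unV σ) (emb t))))

prT-sub : ∀ {n m} (σ : Fin n → Tm false m) t → prT (sub σ t) ≡ sub (sub³ σ) (prT t)
prT-sub σ t = trans (cong (ren prV) (emb-sub (λ _ → refl) t))
  (trans (ren-sub (λ _ → refl) (emb t)) (sym (sub-ren (sub³-prV σ) (emb t))))

skip₂-sub³ : ∀ {n m} (σ : Fin n → Tm false m) j →
             ren skip₂ (sub³ (liftS σ) j) ≡ liftS (liftS (liftS (liftS (liftS (sub³ σ))))) (skip₂ j)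
skip₂-sub³ σ zero                = refl
skip₂-sub³ σ (suc zero)          = refl
skip₂-sub³ σ (suc (suc zero))    = refl
skip₂-sub³ σ (suc (suc (suc k))) = trans (cong (ren skip₂) (sub³-wk σ k)) (skip₂-wk3 (sub³ σ k))

projΣ-sub³ : ∀ {n m} (σ : Fin n → Tm false m) j →
             sub projΣ (sub³ (liftS σ) j) ≡ sub (liftS (liftS (liftS (sub³ σ)))) (projΣ j)
projΣ-sub³ σ zero                = refl
projΣ-sub³ σ (suc zero)          = refl
projΣ-sub³ σ (suc (suc zero))    = refl
projΣ-sub³ σ (suc (suc (suc k))) = trans (cong (sub projΣ) (sub³-wk σ k)) (projΣ-wk3 (sub³ σ k))

star⁺-sub : ∀ {n m} (σ : Fin n → Tm false m) (t : Tm false n) →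
            star⁺ (sub σ t) ≡ sub (sub³ σ) (star⁺ t)
star⁺-sub σ (var i) = sym (sub³-stV σ i)
star⁺-sub σ ⋆       = refl
star⁺-sub σ U       = refl
star⁺-sub σ T       = refl
star⁺-sub σ Π̂       = refl
star⁺-sub σ Σ̂       = refl
star⁺-sub σ ⋆̂       = refl
star⁺-sub σ (Π A B) = cong₄ relΠ
  (trans (cong wk2 (unT-sub σ A)) (sym (sub-wk2 (sub³ σ) (unT A))))
  (trans (cong wk3 (prT-sub σ A)) (sym (sub-wk3 (sub³ σ) (prT A))))
  (trans (cong wk4 (star⁺-sub σ A)) (sym (sub-wk4 (sub³ σ) (star⁺ A))))
  (trans (cong (ren skip₂) (star⁺-sub (liftS σ) B))
    (trans (ren-sub (λ _ → refl) (star⁺ B))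
      (trans (sub-ext (skip₂-sub³ σ) (star⁺ B)) (sym (sub-ren (λ _ → refl) (star⁺ B))))))
star⁺-sub σ (Σ A B) = cong₂ relΣ
  (trans (cong wk2 (star⁺-sub σ A)) (sym (sub-wk2 (sub³ σ) (star⁺ A))))
  (trans (cong (sub projΣ) (star⁺-sub (liftS σ) B))
    (trans (sub-sub (λ _ → refl) (star⁺ B))
      (trans (sub-ext (projΣ-sub³ σ) (star⁺ B)) (sym (sub-sub (λ _ → refl) (star⁺ B))))))
star⁺-sub σ (lam A t) = cong₄ lamRel (unT-sub σ A)
  (trans (cong wk (prT-sub σ A)) (sym (sub-wk (sub³ σ) (prT A))))
  (trans (cong wk2 (star⁺-sub σ A)) (sym (sub-wk2 (sub³ σ) (star⁺ A))))
  (trans (star⁺-sub (liftS σ) t) (sub-ext (sub³-liftS σ) (star⁺ t)))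
star⁺-sub σ (app s t)  = cong₄ (λ a b c d → a · b · c · d)
  (star⁺-sub σ s) (unT-sub σ t) (prT-sub σ t) (star⁺-sub σ t)
star⁺-sub σ (pair s t) = cong₂ pair (star⁺-sub σ s) (star⁺-sub σ t)
star⁺-sub σ (fst t)    = cong fst (star⁺-sub σ t)
star⁺-sub σ (snd t)    = cong snd (star⁺-sub σ t)

-- The case needed for β: (s[t/x])⁺ = s⁺[t, t', t⁺ / x, x', x*].
star⁺-sub0 : ∀ {n} (s : Tm false (suc n)) t →
             star⁺ (sub0 s t) ≡ sub (σ₃ (unT t) (prT t) (star⁺ t)) (star⁺ s)
star⁺-sub0 s t = trans (cong star⁺ (sub0-as-sub s t))
  (trans (star⁺-sub (σ₁ t) s) (sub-ext sub³-σ₁ (star⁺ s)))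
  where
  sub³-σ₁ : ∀ j → sub³ (σ₁ t) j ≡ σ₃ (unT t) (prT t) (star⁺ t) j
  sub³-σ₁ zero                = refl
  sub³-σ₁ (suc zero)          = refl
  sub³-σ₁ (suc (suc zero))    = refl
  sub³-σ₁ (suc (suc (suc k))) = trans (sub³-var (λ i → i) k) (cong var (ren³-id k))

T⁺-β₃ : ∀ {n} (a b c : Tm true n) →
        T⁺ · a · b · c ≃ lam ⋆ (lam ⋆ (Rel · wk2 a · wk2 b · wk2 c · v1 · v0))
T⁺-β₃ a b c = β₃ ⋆ ⋆ ⋆ _ a b c

T⁺-β₅ : ∀ {n} (a b c x y : Tm true n) → T⁺ · a · b · c · x · y ≃ Rel · a · b · c · x · y
T⁺-β₅ a b c x y = ≃-trans (app2-cong x y (T⁺-β₃ a b c))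
  (≃-trans (β₂ ⋆ ⋆ _ x y)
    (≡→≃ (cong₃ (λ a b c → Rel · a · b · c · x · y)
      (sub-wk2-cancel (λ _ → refl) a) (sub-wk2-cancel (λ _ → refl) b)
      (sub-wk2-cancel (λ _ → refl) c))))

reorder-β₆ : ∀ {n} (K : ∀ {m} → Tm true m) →
             (∀ {m k} (σ : Fin m → Tm true k) → sub σ K ≡ K) →
             (a b c d e f : Tm true n) →
             lam ⋆ (lam ⋆ (lam ⋆ (lam ⋆ (lam ⋆ (lam ⋆ (K · v5 · v4 · v2 · v1 · v3 · v0))))))
               · a · b · c · d · e · f
             ≃ K · a · b · d · e · c · f
reorder-β₆ K K-closed a b c d e f =
  ≃-trans (app-cong (app2-cong d e (β₃ ⋆ ⋆ ⋆ _ a b c)) ≃-refl)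
  (≃-trans (β₃ ⋆ ⋆ ⋆ _ d e f)
    (≡→≃ (cong₄ (λ k a b c → k · a · b · d · e · c · f)
      (trans (cong (sub _) (K-closed _)) (K-closed _))
      (sub-wk3-cancel (λ _ → refl) a) (sub-wk3-cancel (λ _ → refl) b)
      (sub-wk3-cancel (λ _ → refl) c))))

Π̂⁺-β₆ : ∀ {n} (a b c d e f : Tm true n) → Π̂⁺ · a · b · c · d · e · f ≃ Π̂* · a · b · d · e · c · f
Π̂⁺-β₆ = reorder-β₆ Π̂* (λ _ → refl)

Σ̂⁺-β₆ : ∀ {n} (a b c d e f : Tm true n) → Σ̂⁺ · a · b · c · d · e · f ≃ Σ̂* · a · b · d · e · c · f
Σ̂⁺-β₆ = reorder-β₆ Σ̂* (λ _ → refl)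

-- The equation T (Π̂ A B) = Π x:TA. T (B x) is mapped to the equation RelΠ̂*.
star⁺-TΠ̂ : ∀ {n} (A B : Tm false n) →
           star⁺ (T · (Π̂ · A · B)) ≃ star⁺ (Π (T · A) (T · (wk B · var zero)))
star⁺-TΠ̂ A B = ≃-trans
  (≃-trans (app-cong ≃-refl (Π̂⁺-β₆ _ _ _ _ _ _))
    (≃-trans (T⁺-β₃ _ _ _) (lam-cong ≃-refl (lam-cong ≃-refl (RelΠ̂* _ _ _ _ _ _ _ _ _ _)))))
  (≃-sym (lam-cong ≃-refl (lam-cong ≃-refl (Π-cong ≃-refl (Π-cong ≃-refl
    (Π-cong (T⁺-β₅ _ _ _ _ _) (≃-trans (≡→≃ body) (T⁺-β₅ _ _ _ _ _))))))))
  where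
  body : ren skip₂ (star⁺ (T · (wk B · var zero))) · (v4 · v2) · (v3 · v1) ≡
         T⁺ · (wk5 (unT B) · v2) · (wk5 (prT B) · v1) · (wk5 (star⁺ B) · v2 · v1 · v0)
            · (v4 · v2) · (v3 · v1)
  body = cong₃ (λ a b c → T⁺ · (a · v2) · (b · v1) · (c · v2 · v1 · v0) · (v4 · v2) · (v3 · v1))
    (trans (cong (ren skip₂) (unT-wk B)) (skip₂-wk3 (unT B)))
    (trans (cong (ren skip₂) (prT-wk B)) (skip₂-wk3 (prT B)))
    (trans (cong (ren skip₂) (star⁺-wk B)) (skip₂-wk3 (star⁺ B)))

-- The equation T (Σ̂ A B) = Σ x:TA. T (B x) is mapped to the equation RelΣ̂*.
star⁺-TΣ̂ : ∀ {n} (A B : Tm false n) →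
           star⁺ (T · (Σ̂ · A · B)) ≃ star⁺ (Σ (T · A) (T · (wk B · var zero)))
star⁺-TΣ̂ A B = ≃-trans
  (≃-trans (app-cong ≃-refl (Σ̂⁺-β₆ _ _ _ _ _ _))
    (≃-trans (T⁺-β₃ _ _ _) (lam-cong ≃-refl (lam-cong ≃-refl (RelΣ̂* _ _ _ _ _ _ _ _ _ _)))))
  (≃-sym (lam-cong ≃-refl (lam-cong ≃-refl
    (Σ-cong (T⁺-β₅ _ _ _ _ _) (≃-trans (≡→≃ body) (T⁺-β₅ _ _ _ _ _))))))
  where
  body : sub projΣ (star⁺ (T · (wk B · var zero))) · snd v2 · snd v1 ≡
         T⁺ · (wk3 (unT B) · fst v2) · (wk3 (prT B) · fst v1)
            · (wk3 (star⁺ B) · fst v2 · fst v1 · v0) · snd v2 · snd v1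
  body = cong₃ (λ a b c → T⁺ · (a · fst v2) · (b · fst v1) · (c · fst v2 · fst v1 · v0)
                             · snd v2 · snd v1)
    (trans (cong (sub projΣ) (unT-wk B)) (projΣ-wk3 (unT B)))
    (trans (cong (sub projΣ) (prT-wk B)) (projΣ-wk3 (prT B)))
    (trans (cong (sub projΣ) (star⁺-wk B)) (projΣ-wk3 (star⁺ B)))

-- The equation T ⋆̂ = U is mapped to the equation Relrefl.
star⁺-T⋆̂ : ∀ {n} → star⁺ (T · ⋆̂) ≃ star⁺ (U {false} {n})
star⁺-T⋆̂ = ≃-trans (T⁺-β₃ _ _ _) (lam-cong ≃-refl (lam-cong ≃-refl (Relrefl _ _ _ _)))

star⁺-≃ : ∀ {n} {s t : Tm false n} → s ≃ t → star⁺ s ≃ star⁺ t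
star⁺-≃ (β A s t) = ≃-trans (β₃ _ _ _ (star⁺ s) _ _ _) (≡→≃ (sym (star⁺-sub0 s t)))
star⁺-≃ (π₁β s t) = π₁β _ _
star⁺-≃ (π₂β s t) = π₂β _ _
star⁺-≃ (TΠ̂ A B)  = star⁺-TΠ̂ A B
star⁺-≃ (TΣ̂ A B)  = star⁺-TΣ̂ A B
star⁺-≃ T⋆̂        = star⁺-T⋆̂
star⁺-≃ ≃-refl        = ≃-refl
star⁺-≃ (≃-sym p)     = ≃-sym (star⁺-≃ p)
star⁺-≃ (≃-trans p q) = ≃-trans (star⁺-≃ p) (star⁺-≃ q)
star⁺-≃ (Π-cong p q)  = lam-cong ≃-refl (lam-cong ≃-refl
  (Π-cong (wk-≃ (wk-≃ (unT-≃ p))) (Π-cong (wk-≃ (wk-≃ (wk-≃ (prT-≃ p))))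
    (Π-cong (app2-cong _ _ (wk-≃ (wk-≃ (wk-≃ (wk-≃ (star⁺-≃ p))))))
            (app2-cong _ _ (ren-≃ skip₂ (star⁺-≃ q)))))))
star⁺-≃ (Σ-cong p q)  = lam-cong ≃-refl (lam-cong ≃-refl
  (Σ-cong (app2-cong _ _ (wk-≃ (wk-≃ (star⁺-≃ p)))) (app2-cong _ _ (sub-≃ projΣ (star⁺-≃ q)))))
star⁺-≃ (lam-cong p q) = lam-cong (unT-≃ p) (lam-cong (wk-≃ (prT-≃ p))
  (lam-cong (app2-cong _ _ (wk-≃ (wk-≃ (star⁺-≃ p)))) (star⁺-≃ q)))
star⁺-≃ (app-cong p q)  = app-cong (app-cong (app-cong (star⁺-≃ p) (unT-≃ q)) (prT-≃ q)) (star⁺-≃ q)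
star⁺-≃ (pair-cong p q) = pair-cong (star⁺-≃ p) (star⁺-≃ q)
star⁺-≃ (fst-cong p)    = fst-cong (star⁺-≃ p)
star⁺-≃ (snd-cong p)    = snd-cong (star⁺-≃ p)

-- Part 3: star⁺ extends star.  The only discrepancy between
-- star⁺ ∘ reflect and star is that the constants T, Π̂, Σ̂ appear as their
-- β-expandable translations T⁺, Π̂⁺, Σ̂⁺.
mutual
  star⁺-reflect : ∀ {n} (m : Pre n) → star⁺ (reflect m) ≃ star m
  star⁺-reflect (var i)    = ≃-refl
  star⁺-reflect ⋆          = ≃-refl
  star⁺-reflect (Π A B)    = ≃-trans (Π̂⁺-β₆ _ _ _ _ _ _)
    (app-cong (app-cong ≃-refl (star⁺-reflect A)) (star⁺-reflect-lam A B))
  star⁺-reflect (Σ A B)    = ≃-trans (Σ̂⁺-β₆ _ _ _ _ _ _)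
    (app-cong (app-cong ≃-refl (star⁺-reflect A)) (star⁺-reflect-lam A B))
  star⁺-reflect (lam A t)  = star⁺-reflect-lam A t
  star⁺-reflect (app f a)  = app-cong (app2-cong _ _ (star⁺-reflect f)) (star⁺-reflect a)
  star⁺-reflect (pair a b) = pair-cong (star⁺-reflect a) (star⁺-reflect b)
  star⁺-reflect (fst p)    = fst-cong (star⁺-reflect p)
  star⁺-reflect (snd p)    = snd-cong (star⁺-reflect p)

  star⁺-reflect-lam : ∀ {n} (A : Pre n) (t : Pre (suc n)) →
                      star⁺ (lam (T · reflect A) (reflect t)) ≃ lam³ A (star A) (star t)
  star⁺-reflect-lam A t = lam-cong ≃-refl (lam-cong ≃-refl
    (lam-cong (≃-trans (T⁺-β₅ _ _ _ _ _)
                (app2-cong _ _ (app-cong ≃-refl (wk-≃ (wk-≃ (star⁺-reflect A))))))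
              (star⁺-reflect t)))

mainTheorem6 : ∀ {n : ℕ} (m k : Pre n) →
    reflect m ≃ reflect k → star m ≃ star k
mainTheorem6 {n} m k p = begin
  star m             ≈⟨ star⁺-reflect m ⟨
  star⁺ (reflect m)  ≈⟨ star⁺-≃ p ⟩
  star⁺ (reflect k)  ≈⟨ star⁺-reflect k ⟩
  star k             ∎
  where open SetoidReasoning (≃-setoid true (tri n))
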